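{- Let $t$ be a term with $\mathrm{normal}(t)$ and let $\Phi$ be a derivation in the CbNeed type system of $\Gamma\vdash^{(m,e)} t:[\mathsf{normal}]$. Then $\Gamma$ is empty (so $\Phi$ is tight) and $m=e=0$.
   Context: Terms: $t,s ::= x \mid \lambda x.t \mid t\,s \mid t[x\leftarrow s]$, where $t[x\leftarrow s]$ (explicit substitution) binds $x$ in $t$. $\mathrm{normal}$: least predicate with $\mathrm{normal}(\lambda x.t)$ and $\mathrm{normal}(t)\Rightarrow\mathrm{normal}(t[x\leftarrow s])$. CbNeed types: linear types $L ::= \mathsf{normal}\mid M\to N$; multi types $M,N ::= [L_i]_{i\in J}$ finite multisets, $\mathbf 0$ empty multiset, $\uplus$ union. Type contexts $\Gamma$ map variables to multi types, all but finitely many to $\mathbf 0$; $\mathrm{dom}(\Gamma)=\{x\mid\Gamma(x)\ne\mathbf 0\}$; $\Gamma$ empty if its domain is empty; $\uplus$ pointwise; $\Gamma,x:M$ means $\Gamma\uplus(x\mapsto M)$ with $x\notin\mathrm{dom}(\Gamma)$. Rules: (ax) $x:M\vdash^{(0,1)} x:M$ (with $M\neq\mathbf 0$); (normal) $\vdash^{(0,0)}\lambda x.t:\mathsf{normal}$; (fun) from $\Gamma,x:M\vdash^{(m,e)} t:N$ infer $\Gamma\vdash^{(m,e)}\lambda x.t:M\to N$; (many) from $\Gamma_i\vdash^{(m_i,e_i)}\lambda x.t:L_i$, $i\in J$, $J\neq\emptyset$, infer $\biguplus_i\Gamma_i\vdash^{(\sum m_i,\sum e_i)}\lambda x.t:[L_i]_{i\in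 J}$; (app$_{gc}$) from $\Gamma\vdash^{(m,e)} t:[\mathbf 0\to M]$ infer $\Gamma\vdash^{(m+1,e)} t\,s:M$; (app) from $\Gamma\vdash^{(m,e)} t:[N\to M]$ and $\Pi\vdash^{(m',e')} s:N$ with $N\ne\mathbf 0$ infer $\Gamma\uplus\Pi\vdash^{(m+m'+1,e+e')} t\,s:M$; (ES$_{gc}$) from $\Gamma\vdash^{(m,e)} t:M$ with $\Gamma(x)=\mathbf 0$ infer $\Gamma\vdash^{(m,e)} t[x\leftarrow s]:M$; (ES) from $\Gamma,x:N\vdash^{(m,e)} t:M$ and $\Pi\vdash^{(m',e')} s:N$ with $N\ne\mathbf 0$ infer $\Gamma\uplus\Pi\vdash^{(m+m',e+e')} t[x\leftarrow s]:M$. A derivation of $\Gamma\vdash^{(m,e)} t:M$ is tight if $M=[\mathsf{normal}]$ and $\Gamma$ is empty. -}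

module Defs where

open import Data.Nat using (ℕ; zero; suc; _+_; _≟_)
open import Data.List using (List; []; _∷_; _++_)
open import Data.List.Relation.Binary.Permutation.Homogeneous using (Permutation)
open import Data.Product using (_×_; _,_)
open import Relation.Nullary using (¬_; yes; no)
open import Relation.Binary.PropositionalEquality using (_≡_)

Var : Set
Var = ℕ

data Term : Set where
  var : Var → Term
  lam : Var → Term → Term
  app : Term → Term → Term
  es  : Term → Var → Term → Term   -- t[x←s]

data normal : Term → Set where
  normal-lam : ∀ {x t} → normal (lam x t)
  normal-es  : ∀ {t x s} → normal t → normal (es t x s)

-- Linear and multi types; multi types are finite multisets, represented as
-- lists considered up to permutation (recursively), see _≈L_ / _≈M_.
data LTy : Set where
  tnormal : LTy
  _⇒_     : List LTy → List LTy → LTy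

MTy : Set
MTy = List LTy

𝟎 : MTy
𝟎 = []

data _≈L_ : LTy → LTy → Set
_≈M_ : MTy → MTy → Set

data _≈L_ where
  ≈normal : tnormal ≈L tnormal
  ≈arrow  : ∀ {M M' N N'} → M ≈M M' → N ≈M N' → (M ⇒ N) ≈L (M' ⇒ N')

M ≈M N = Permutation _≈L_ M N

-- Type contexts: maps from variables to multi types. (Finite support is
-- automatic for contexts built by the rules.)
Ctx : Set
Ctx = Var → MTy

∅ : Ctx
∅ _ = []

_⊎c_ : Ctx → Ctx → Ctx
(Γ ⊎c Δ) y = Γ y ++ Δ y

_≈c_ : Ctx → Ctx → Set
Γ ≈c Δ = ∀ y → Γ y ≈M Δ y

_↦_ : Var → MTy → Ctx
(x ↦ M) y with x ≟ y
... | yes _ = M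
... | no  _ = []

-- Γ , x : M   (requires x ∉ dom Γ, i.e. Γ x = 0)
_,,_∶_ : Ctx → Var → MTy → Ctx
Γ ,, x ∶ M = Γ ⊎c (x ↦ M)

Empty : Ctx → Set
Empty Γ = ∀ y → Γ y ≡ []

NonEmptyM : MTy → Set
NonEmptyM M = ¬ (M ≡ [])

data Ty : Set where
  lin   : LTy → Ty
  multi : MTy → Ty

data _≈T_ : Ty → Ty → Set where
  ≈lin   : ∀ {L L'} → L ≈L L' → lin L ≈T lin L'
  ≈multi : ∀ {M M'} → M ≈M M' → multi M ≈T multi M'

data _⊢[_,_]_∶_ : Ctx → ℕ → ℕ → Term → Ty → Set
data Many (x : Var) (t : Term) : Ctx → ℕ → ℕ → MTy → Set

data _⊢[_,_]_∶_ where
  ax : ∀ {x M} → NonEmptyM M →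
       (x ↦ M) ⊢[ 0 , 1 ] var x ∶ multi M
  normal-rule : ∀ {x t} → ∅ ⊢[ 0 , 0 ] lam x t ∶ lin tnormal
  fun : ∀ {Γ x t M N m e} → Γ x ≡ [] →
        (Γ ,, x ∶ M) ⊢[ m , e ] t ∶ multi N →
        Γ ⊢[ m , e ] lam x t ∶ lin (M ⇒ N)
  many : ∀ {Γ x t M m e} → Many x t Γ m e M →
         Γ ⊢[ m , e ] lam x t ∶ multi M
  app-gc : ∀ {Γ t s M m e} →
           Γ ⊢[ m , e ] t ∶ multi ((𝟎 ⇒ M) ∷ []) →
           Γ ⊢[ suc m , e ] app t s ∶ multi M
  app-rule : ∀ {Γ Π t s M N m e m' e'} → NonEmptyM N →
           Γ ⊢[ m , e ] t ∶ multi ((N ⇒ M) ∷ []) →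
           Π ⊢[ m' , e' ] s ∶ multi N →
           (Γ ⊎c Π) ⊢[ suc (m + m') , e + e' ] app t s ∶ multi M
  es-gc : ∀ {Γ t x s M m e} → Γ x ≡ [] →
          Γ ⊢[ m , e ] t ∶ multi M →
          Γ ⊢[ m , e ] es t x s ∶ multi M
  es-rule : ∀ {Γ Π t x s M N m e m' e'} → NonEmptyM N → Γ x ≡ [] →
          (Γ ,, x ∶ N) ⊢[ m , e ] t ∶ multi M →
          Π ⊢[ m' , e' ] s ∶ multi N →
          (Γ ⊎c Π) ⊢[ m + m' , e + e' ] es t x s ∶ multi M
  -- multisets and contexts are taken up to multiset equality
  conv : ∀ {Γ Γ' t T T' m e} → Γ ≈c Γ' → T ≈T T' →
         Γ ⊢[ m , e ] t ∶ T → Γ' ⊢[ m , e ] t ∶ T'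

data Many x t where
  many-one  : ∀ {Γ L m e} → Γ ⊢[ m , e ] lam x t ∶ lin L →
              Many x t Γ m e (L ∷ [])
  many-cons : ∀ {Γ Δ L M m e m' e'} → Γ ⊢[ m , e ] lam x t ∶ lin L →
              Many x t Δ m' e' M →
              Many x t (Γ ⊎c Δ) (m + m') (e + e') (L ∷ M)

module Submission where

-- Call a judgement type "normal" when it is  lin normal  or a
-- multi type all of whose elements are  normal.  We show, by induction on the
-- derivation (mutually with the premises of the (many) rule), that a normal
-- term typed with a normal type has an empty context and counters (0, 0):
--   * (normal) is the base case; (fun) cannot produce a normal type;
--   * (many) joins the context-free, cost-free typings of its premises;
--   * (ES_gc) is passed through, while (ES) is impossible, since the
--     induction hypothesis would give an empty context  Γ , x : N  with N ≠ 0;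
--   * (conv) is handled by invariance of normal types and of empty contexts
--     under multiset equality.

open import Defs
open import Data.Nat using (ℕ; _+_; _≟_)
open import Data.List using (List; []; _∷_; _++_)
open import Data.List.Properties using (++-conicalʳ)
open import Data.List.Relation.Unary.All using (All; []; _∷_)
open import Data.List.Relation.Binary.Permutation.Homogeneous as Perm using (Permutation)
open import Data.List.Relation.Binary.Pointwise using (Pointwise; []; _∷_)
open import Data.Product using (_×_; _,_)
open import Relation.Nullary using (¬_; yes; no; contradiction)
open import Level using (0ℓ)
open import Relation.Binary.Core using (Rel)
open import Relation.Binary.PropositionalEquality using (_≡_; refl; cong₂; subst)

≈L-normal : ∀ {L} → L ≈L tnormal → L ≡ tnormal
≈L-normal ≈normal = refl

All-reflects-Permutation : ∀ {A : Set} {R : Rel A 0ℓ} {P : A → Set} →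
  (∀ {x y} → R x y → P y → P x) →
  ∀ {xs ys} → Permutation R xs ys → All P ys → All P xs
All-reflects-Permutation {R = R} {P} reflect = go
  where
  pointwise : ∀ {xs ys} → Pointwise R xs ys → All P ys → All P xs
  pointwise []       []         = []
  pointwise (r ∷ rs) (py ∷ pys) = reflect r py ∷ pointwise rs pys

  go : ∀ {xs ys} → Permutation R xs ys → All P ys → All P xs
  go (Perm.refl rs)      pys             = pointwise rs pys
  go (Perm.prep r p)     (py ∷ pys)      = reflect r py ∷ go p pys
  go (Perm.swap r₁ r₂ p) (py ∷ px ∷ pys) = reflect r₁ px ∷ reflect r₂ py ∷ go p pys
  go (Perm.trans p q)    pys             = go p (go q pys)

Permutation-[] : ∀ {A : Set} {R : Rel A 0ℓ} {ys : List A} →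
  Permutation R [] ys → ys ≡ []
Permutation-[] (Perm.refl [])   = refl
Permutation-[] (Perm.trans p q) with refl ← Permutation-[] p = Permutation-[] q

data NormalTy : Ty → Set where
  lin-normal   : NormalTy (lin tnormal)
  multi-normal : ∀ {M} → All (_≡ tnormal) M → NormalTy (multi M)

-- Being normal is reflected by equality of judgement types, so it survives
-- the (conv) rule read backwards.
NormalTy-reflects-≈T : ∀ {T T'} → T ≈T T' → NormalTy T' → NormalTy T
NormalTy-reflects-≈T (≈lin r) lin-normal with refl ← ≈L-normal r = lin-normal
NormalTy-reflects-≈T (≈multi p) (multi-normal ns) =
  multi-normal (All-reflects-Permutation reflect p ns)
  where
  reflect : ∀ {L L'} → L ≈L L' → L' ≡ tnormal → L ≡ tnormal
  reflect r refl = ≈L-normal r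

Empty-resp-≈c : ∀ {Γ Γ'} → Γ ≈c Γ' → Empty Γ → Empty Γ'
Empty-resp-≈c {Γ} {Γ'} c empty y =
  Permutation-[] (subst (λ A → A ≈M Γ' y) (empty y) (c y))

Empty-⊎c : ∀ {Γ Δ} → Empty Γ → Empty Δ → Empty (Γ ⊎c Δ)
Empty-⊎c emptyΓ emptyΔ y = cong₂ _++_ (emptyΓ y) (emptyΔ y)

↦-self : ∀ x M → (x ↦ M) x ≡ M
↦-self x M with x ≟ x
... | yes _  = refl
... | no x≢x = contradiction refl x≢x

¬Empty-extension : ∀ {Γ x N} → NonEmptyM N → ¬ Empty (Γ ,, x ∶ N)
¬Empty-extension {Γ} {x} {N} N≢0 empty =
  N≢0 (subst (_≡ []) (↦-self x N) (++-conicalʳ (Γ x) ((x ↦ N) x) (empty x)))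

Costless : Ctx → ℕ → ℕ → Set
Costless Γ m e = Empty Γ × (m ≡ 0 × e ≡ 0)

Costless-⊎c : ∀ {Γ Δ m m' e e'} → Costless Γ m e → Costless Δ m' e' →
  Costless (Γ ⊎c Δ) (m + m') (e + e')
Costless-⊎c (emptyΓ , m≡0 , e≡0) (emptyΔ , m'≡0 , e'≡0) =
  Empty-⊎c emptyΓ emptyΔ , cong₂ _+_ m≡0 m'≡0 , cong₂ _+_ e≡0 e'≡0

normal-costless : ∀ {t Γ m e T} → normal t → Γ ⊢[ m , e ] t ∶ T →
  NormalTy T → Costless Γ m e
many-costless : ∀ {x t Γ m e M} → Many x t Γ m e M →
  All (_≡ tnormal) M → Costless Γ m e

normal-costless _ normal-rule _ = (λ _ → refl) , refl , refl
normal-costless _ (many ds) (multi-normal ns) = many-costless ds ns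
normal-costless (normal-es nt) (es-gc _ d) nT = normal-costless nt d nT
normal-costless (normal-es nt) (es-rule {Γ = Γ} {x = x} N≢0 _ d _) nT
  with (empty , _) ← normal-costless nt d nT =
  contradiction empty (¬Empty-extension {Γ} {x} N≢0)
normal-costless nt (conv c eqT d) nT
  with (empty , costs) ← normal-costless nt d (NormalTy-reflects-≈T eqT nT) =
  Empty-resp-≈c c empty , costs

many-costless (many-one d) (refl ∷ []) = normal-costless normal-lam d lin-normal
many-costless (many-cons d ds) (refl ∷ ns) =
  Costless-⊎c (normal-costless normal-lam d lin-normal) (many-costless ds ns)

proposition11 : ∀ {t : Term} {Γ : Ctx} {m e : ℕ} → normal t →
    Γ ⊢[ m , e ] t ∶ multi (tnormal ∷ []) →
    Empty Γ × (m ≡ 0 × e ≡ 0)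
proposition11 nt d = normal-costless nt d (multi-normal (refl ∷ []))
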